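{- The generating functions $EV(x,y,z,u)$ and $OD(x,y,z,u)$ satisfy \[ EV(x,y,z,u)=\frac{xzu}{zu-1}\bigl(uz\,OD(x,y,z,zu)-OD(x,y,z,1)\bigr),\qquad OD(x,y,z,u)=xyu+\frac{xyu}{yu-1}\bigl(uy\,EV(x,y,z,yu)-EV(x,y,z,1)\bigr), \] which is equivalent to the matrix equation \[ \mathbf{V}(u)=\mathbf{M}(u)\,\mathbf{V}(yzu)-\mathbf{N}(u)\,\mathbf{V}(1)+\mathbf{B}(u), \] where $\mathbf{V}(u)=\begin{pmatrix} EV(x,y,z,u)\\ OD(x,y,z,u)\end{pmatrix}$, \[\mathbf{M}(u)= \begin{pmatrix} \frac{x^2y^2z^4u^4}{(uz-1)(uyz-1)}& 0 \\ 0& \frac{x^2y^4z^2u^4}{(uy-1)(uyz-1)} \end{pmatrix}, \quad \mathbf{N}(u)= \begin{pmatrix} \frac{x^2yz^3u^3}{(uz-1)(uyz-1)}& \frac{xzu}{uz-1}\\ \frac{xyu}{uy-1}& \frac{x^2y^3zu^3}{(uy-1)(uyz-1)} \end{pmatrix},\quad \mathbf{B}(u)= \begin{pmatrix} \frac{x^2yz^3u^3}{uz-1}\\ xyu \end{pmatrix}. \]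
   Context: A Catalan word of length $n\geq1$ is a sequence $w_1\cdots w_n$ of nonnegative integers with $w_1=0$ and $w_i\leq w_{i-1}+1$; its Catalan polyomino is the bargraph whose $i$th column has $w_i+1$ cells, columns bottom-aligned. For a Catalan polyomino $P$: $\mathrm{lth}(P)$ is its number of columns, $\mathrm{last}(P)$ the number of cells in its last column, $\mathrm{ver}(P)$ the total number of cells in columns of odd index (first column has index 1), $\mathrm{white}(P)$ the total number of cells in columns of even index. $EV(x,y,z,u)=\sum x^{\mathrm{lth}(P)}y^{\mathrm{ver}(P)}z^{\mathrm{white}(P)}u^{\mathrm{last}(P)}$ over Catalan polyominoes $P$ with an even number of columns, and $OD(x,y,z,u)$ is the same sum over those with an odd number of columns. -}

module Defs where

open import Data.Nat using (ℕ; zero; suc; _+_; _*_; _≤ᵇ_; _≡ᵇ_)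
open import Data.Integer using (ℤ; +_) renaming (_+_ to _+ℤ_; _*_ to _*ℤ_; -_ to -ℤ_)
open import Data.Bool using (Bool; true; false; _∧_; not; if_then_else_)
open import Data.List using (List; []; _∷_; map; concatMap; filter; length; upTo; foldr)
open import Data.Product using (_×_; _,_)
open import Data.Maybe using (Maybe; just; nothing)
open import Relation.Binary.PropositionalEquality using (_≡_)
open import Relation.Nullary.Decidable using (does)
open import Function using (_∘_)
open import Data.Bool.Properties using (T?)

stepsOK : ℕ → List ℕ → Bool
stepsOK prev []       = true
stepsOK prev (w ∷ ws) = (w ≤ᵇ suc prev) ∧ stepsOK w ws

isCatalan : List ℕ → Bool
isCatalan []       = false
isCatalan (w ∷ ws) = (w ≡ᵇ 0) ∧ stepsOK w ws

seqs : ℕ → ℕ → List (List ℕ)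
seqs zero    m = [] ∷ []
seqs (suc n) m = concatMap (λ v → map (v ∷_) (seqs n m)) (upTo m)

-- all Catalan words of length n (necessarily w_i ≤ i-1 ≤ n-1)
catalanWords : ℕ → List (List ℕ)
catalanWords n = filter (λ w → T? (isCatalan w)) (seqs n n)

-- statistics of the Catalan polyomino of a word (column i has w_i + 1 cells)
mutual
  -- cells in columns of odd index (the list starts at an odd index)
  ver : List ℕ → ℕ
  ver []       = 0
  ver (w ∷ ws) = suc w + white ws

  -- cells in columns of even index (the list starts at an odd index)
  white : List ℕ → ℕ
  white []       = 0
  white (w ∷ ws) = ver ws

lth : List ℕ → ℕ
lth = length

lastCol : List ℕ → ℕ
lastCol []           = 0
lastCol (w ∷ [])     = suc w
lastCol (w ∷ v ∷ ws) = lastCol (v ∷ ws)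

-- Formal power series in x, y, z, u with integer coefficients:
-- S n a b c is the coefficient of x^n y^a z^b u^c.

Series : Set
Series = ℕ → ℕ → ℕ → ℕ → ℤ

_≋_ : Series → Series → Set
F ≋ G = ∀ n a b c → F n a b c ≡ G n a b c
infix 4 _≋_

_⊕_ : Series → Series → Series
(F ⊕ G) n a b c = F n a b c +ℤ G n a b c
infixl 6 _⊕_

⊖_ : Series → Series
(⊖ F) n a b c = -ℤ (F n a b c)

_⊖_ : Series → Series → Series
F ⊖ G = F ⊕ (⊖ G)
infixl 6 _⊖_

one : Series
one zero zero zero zero = + 1
one _    _    _    _    = + 0

_-?_ : ℕ → ℕ → Maybe ℕ
m     -? zero  = just m
zero  -? suc n = nothing
suc m -? suc n = m -? n

monoMul : ℕ → ℕ → ℕ → ℕ → Series → Series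
monoMul p q r s F n a b c with n -? p | a -? q | b -? r | c -? s
... | just n' | just a' | just b' | just c' = F n' a' b' c'
... | _       | _       | _       | _       = + 0

record Term : Set where
  constructor term
  field
    coeff : ℤ
    ex ey ez eu : ℕ

Poly : Set
Poly = List Term

mono : ℕ → ℕ → ℕ → ℕ → Poly
mono p q r s = term (+ 1) p q r s ∷ []

_+ₚ_ : Poly → Poly → Poly
P +ₚ Q = P Data.List.++ Q
  where import Data.List

-ₚ_ : Poly → Poly
-ₚ_ = map (λ { (term k p q r s) → term (-ℤ k) p q r s })

_-ₚ_ : Poly → Poly → Poly
P -ₚ Q = P +ₚ (-ₚ Q)

_*ₚ_ : Poly → Poly → Poly
P *ₚ Q = concatMap (λ { (term k p q r s) →
           map (λ { (term l p' q' r' s') → term (k *ℤ l) (p + p') (q + q') (r + r') (s + s') }) Q }) P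

infixl 7 _*ₚ_
infixl 6 _+ₚ_ _-ₚ_

1ₚ : Poly
1ₚ = mono 0 0 0 0

_·_ : Poly → Series → Series
P · F = foldr (λ { (term k p q r s) G n a b c → k *ℤ monoMul p q r s F n a b c +ℤ G n a b c })
              (λ _ _ _ _ → + 0) P
infixr 8 _·_

-- The generating functions EV and OD, with u replaced by y^i z^j u^k.
--
-- GF-sub par i j k is  Σ x^lth(P) y^ver(P) z^white(P) (y^i z^j u^k)^last(P)
-- over Catalan polyominoes P whose number of columns has parity par
-- (true = even).

isEven : ℕ → Bool
isEven zero          = true
isEven (suc zero)    = false
isEven (suc (suc n)) = isEven n

count : {A : Set} → (A → Bool) → List A → ℕ
count P []       = 0
count P (x ∷ xs) = (if P x then 1 else 0) + count P xs

GF-sub : Bool → ℕ → ℕ → ℕ → Series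
GF-sub par i j k n a b c =
  if (if isEven n then par else not par)
  then + count (λ w → (ver w + i * lastCol w ≡ᵇ a)
                    ∧ (white w + j * lastCol w ≡ᵇ b)
                    ∧ (k * lastCol w ≡ᵇ c))
               (catalanWords n)
  else + 0

EV-sub OD-sub : ℕ → ℕ → ℕ → Series
EV-sub = GF-sub true
OD-sub = GF-sub false

EV OD : Series
EV = EV-sub 0 0 1
OD = OD-sub 0 0 1

{-# OPTIONS --safe #-}
-- A Catalan word of length n + 2 is a Catalan word w of length n + 1 followed by a letter h ≤ last(w):
-- the polyomino of w with a column of height t = h + 1 ∈ [1, last(w) + 1] appended.  That column
-- becomes the last one, and by the parity of its index its cells contribute y or z.  So, with
-- u ↦ y^i z^j u^k, the weight of the extension is that of w without its last-column factor times μ^t,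
-- where μ = (y or z) y^i z^j u^k.  The sum over t is geometric: (μ - 1) Σ_{t=1}^{L+1} μ^t = μ^(L+2) - μ,
-- and summed over w the two terms become x μ² times the series of the other parity at u ↦ μ and x μ
-- times it at u = 1.  The one-column polyomino gives the extra term of OD.  Each row of the matrix
-- equation follows by substituting the equation of the other parity, at u ↦ zu or u ↦ yu.
-- Everything is proved coefficientwise: a coefficient of GF-sub counts Catalan words whose exponent
-- vector passes a test, and multiplying by a monomial shifts the exponent being tested.

module Submission where

open import Defs
open import Data.Bool using (Bool; true; false; _∧_; not; if_then_else_)
open import Data.Bool.Properties using (T?; ∧-zeroʳ; if-eta; not-involutive)
import Data.Integer as ℤ
import Data.Integer.Properties as ℤP
import Data.Integer.Tactic.RingSolver as ℤ-Solver
open import Data.Integer using (ℤ; -[1+_])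
  renaming (_+_ to _+ℤ_; _-_ to _-ℤ_; _*_ to _*ℤ_; -_ to -ℤ_)
open import Data.List using (List; []; _∷_; _++_; map; concatMap; filter; upTo; applyUpTo; length)
open import Data.Maybe using (Maybe; just; nothing; _>>=_)
open import Data.Nat using (ℕ; zero; suc; _+_; _*_; _≤ᵇ_; _≡ᵇ_; _<_; z≤n; s≤s; s≤s⁻¹)
open import Data.Nat.Properties
  using ( +-identityʳ; +-assoc; +-comm; +-suc; *-zeroʳ; *-suc; *-distribˡ-+; *-distribʳ-+
        ; m≤m+n; +-monoˡ-≤; ≤-<-trans; n<1+n)
import Data.Nat.Tactic.RingSolver as ℕ-Solver
open import Data.Product using (_×_; _,_)
open import Function using (_∘_)
open import Relation.Binary.PropositionalEquality
open ≡-Reasoning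

-- Finite sums

ind : Bool → ℕ
ind b = if b then 1 else 0

sumOver : {A : Set} → (A → ℕ) → List A → ℕ
sumOver f []       = 0
sumOver f (x ∷ xs) = f x + sumOver f xs

syntax sumOver (λ x → e) xs = ∑[ x ∈ xs ] e

sumBelow : ℕ → (ℕ → ℕ) → ℕ
sumBelow zero    g = 0
sumBelow (suc m) g = g 0 + sumBelow m (λ v → g (suc v))

syntax sumBelow m (λ v → e) = ∑[ v < m ] e

private
  variable
    A B : Set

sumOver-cong : ∀ {f g : A → ℕ} → (∀ x → f x ≡ g x) → ∀ xs → sumOver f xs ≡ sumOver g xs
sumOver-cong f≗g []       = refl
sumOver-cong f≗g (x ∷ xs) = cong₂ _+_ (f≗g x) (sumOver-cong f≗g xs)

sumOver-zero : ∀ (xs : List A) → ∑[ x ∈ xs ] 0 ≡ 0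
sumOver-zero []       = refl
sumOver-zero (x ∷ xs) = sumOver-zero xs

sumOver-++ : ∀ (f : A → ℕ) xs ys → sumOver f (xs ++ ys) ≡ sumOver f xs + sumOver f ys
sumOver-++ f []       ys = refl
sumOver-++ f (x ∷ xs) ys = trans (cong (f x +_) (sumOver-++ f xs ys)) (sym (+-assoc (f x) _ _))

sumOver-+ : ∀ (f g : A → ℕ) xs → ∑[ x ∈ xs ] (f x + g x) ≡ sumOver f xs + sumOver g xs
sumOver-+ f g []       = refl
sumOver-+ f g (x ∷ xs) = trans (cong (f x + g x +_) (sumOver-+ f g xs)) (interchange (f x) (g x) _ _)
  where
  interchange : ∀ a b c d → (a + b) + (c + d) ≡ (a + c) + (b + d)
  interchange = ℕ-Solver.solve-∀

sumOver-*ˡ : ∀ k (f : A → ℕ) xs → ∑[ x ∈ xs ] (k * f x) ≡ k * sumOver f xs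
sumOver-*ˡ k f []       = sym (*-zeroʳ k)
sumOver-*ˡ k f (x ∷ xs) = trans (cong (k * f x +_) (sumOver-*ˡ k f xs)) (sym (*-distribˡ-+ k (f x) _))

count≡sumOver : ∀ (P : A → Bool) xs → count P xs ≡ ∑[ x ∈ xs ] ind (P x)
count≡sumOver P []       = refl
count≡sumOver P (x ∷ xs) = cong (ind (P x) +_) (count≡sumOver P xs)

count-cong : ∀ {P Q : A → Bool} → (∀ x → P x ≡ Q x) → ∀ xs → count P xs ≡ count Q xs
count-cong P≗Q []       = refl
count-cong P≗Q (x ∷ xs) = cong₂ _+_ (cong ind (P≗Q x)) (count-cong P≗Q xs)

count-false : ∀ (xs : List A) → count (λ _ → false) xs ≡ 0
count-false []       = refl
count-false (x ∷ xs) = count-false xs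

sumOver-filter : ∀ (P : A → Bool) f xs →
                 sumOver f (filter (λ x → T? (P x)) xs) ≡ ∑[ x ∈ xs ] (ind (P x) * f x)
sumOver-filter P f []       = refl
sumOver-filter P f (x ∷ xs) with P x
... | true  = cong₂ _+_ (sym (+-identityʳ (f x))) (sumOver-filter P f xs)
... | false = sumOver-filter P f xs

sumOver-map : ∀ (f : B → ℕ) (g : A → B) xs → sumOver f (map g xs) ≡ ∑[ x ∈ xs ] f (g x)
sumOver-map f g []       = refl
sumOver-map f g (x ∷ xs) = cong (f (g x) +_) (sumOver-map f g xs)

sumOver-concatMap : ∀ (f : B → ℕ) (g : A → List B) xs →
                    sumOver f (concatMap g xs) ≡ ∑[ x ∈ xs ] sumOver f (g x)
sumOver-concatMap f g []       = refl
sumOver-concatMap f g (x ∷ xs) =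
  trans (sumOver-++ f (g x) (concatMap g xs)) (cong (sumOver f (g x) +_) (sumOver-concatMap f g xs))

sumOver-applyUpTo : ∀ (g h : ℕ → ℕ) m → sumOver g (applyUpTo h m) ≡ ∑[ v < m ] g (h v)
sumOver-applyUpTo g h zero    = refl
sumOver-applyUpTo g h (suc m) = cong (g (h 0) +_) (sumOver-applyUpTo g (λ v → h (suc v)) m)

sumOver-upTo : ∀ (g : ℕ → ℕ) m → sumOver g (upTo m) ≡ sumBelow m g
sumOver-upTo g = sumOver-applyUpTo g (λ v → v)

sumBelow-cong< : ∀ m {g g' : ℕ → ℕ} → (∀ v → v < m → g v ≡ g' v) → sumBelow m g ≡ sumBelow m g'
sumBelow-cong< zero    g≗g' = refl
sumBelow-cong< (suc m) g≗g' =
  cong₂ _+_ (g≗g' 0 (s≤s z≤n)) (sumBelow-cong< m (λ v v<m → g≗g' (suc v) (s≤s v<m)))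

sumBelow-cong : ∀ m {g g' : ℕ → ℕ} → (∀ v → g v ≡ g' v) → sumBelow m g ≡ sumBelow m g'
sumBelow-cong m g≗g' = sumBelow-cong< m (λ v _ → g≗g' v)

sumBelow-zero : ∀ m → ∑[ v < m ] 0 ≡ 0
sumBelow-zero zero    = refl
sumBelow-zero (suc m) = sumBelow-zero m

sumBelow-snoc : ∀ m g → sumBelow (suc m) g ≡ sumBelow m g + g m
sumBelow-snoc zero    g = +-identityʳ (g 0)
sumBelow-snoc (suc m) g =
  trans (cong (g 0 +_) (sumBelow-snoc m (λ v → g (suc v)))) (sym (+-assoc (g 0) _ _))

sumBelow-telescope : ∀ m (G : ℕ → ℕ) → ∑[ t < m ] G (suc t) + G 0 ≡ G m + sumBelow m G
sumBelow-telescope m G = begin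
  ∑[ t < m ] G (suc t) + G 0   ≡⟨ +-comm _ (G 0) ⟩
  sumBelow (suc m) G           ≡⟨ sumBelow-snoc m G ⟩
  sumBelow m G + G m           ≡⟨ +-comm (sumBelow m G) (G m) ⟩
  G m + sumBelow m G           ∎

suc≤ᵇsuc : ∀ v q → (suc v ≤ᵇ suc q) ≡ (v ≤ᵇ q)
suc≤ᵇsuc zero    q = refl
suc≤ᵇsuc (suc v) q = refl

sumBelow-≤ᵇ : ∀ q m (g : ℕ → ℕ) → q < m → ∑[ v < m ] (ind (v ≤ᵇ q) * g v) ≡ sumBelow (suc q) g
sumBelow-≤ᵇ zero    (suc m) g _ =
  cong₂ _+_ (+-identityʳ (g 0)) (sumBelow-zero m)
sumBelow-≤ᵇ (suc q) (suc m) g q<m =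
  cong₂ _+_ (+-identityʳ (g 0))
    (trans (sumBelow-cong m (λ v → cong (λ b → ind b * g (suc v)) (suc≤ᵇsuc v q)))
           (sumBelow-≤ᵇ q m (λ v → g (suc v)) (s≤s⁻¹ q<m)))

-- Catalan words as one-column extensions

sumOver-seqs-suc : ∀ n m (f : List ℕ → ℕ) →
                   sumOver f (seqs (suc n) m) ≡ ∑[ v < m ] ∑[ s ∈ seqs n m ] f (v ∷ s)
sumOver-seqs-suc n m f = begin
  sumOver f (concatMap (λ v → map (v ∷_) (seqs n m)) (upTo m))
    ≡⟨ sumOver-concatMap f _ (upTo m) ⟩
  ∑[ v ∈ upTo m ] sumOver f (map (v ∷_) (seqs n m))
    ≡⟨ sumOver-cong (λ v → sumOver-map f (v ∷_) (seqs n m)) (upTo m) ⟩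
  ∑[ v ∈ upTo m ] ∑[ s ∈ seqs n m ] f (v ∷ s)
    ≡⟨ sumOver-upTo _ m ⟩
  ∑[ v < m ] ∑[ s ∈ seqs n m ] f (v ∷ s) ∎

sumContinuations : ℕ → ℕ → (List ℕ → ℕ) → ℕ
sumContinuations p zero    f = f []
sumContinuations p (suc n) f = ∑[ v < 2 + p ] sumContinuations v n (λ s → f (v ∷ s))

ind-∧ : ∀ b c x → ind (b ∧ c) * x ≡ ind b * (ind c * x)
ind-∧ true  c x = sym (+-identityʳ (ind c * x))
ind-∧ false c x = refl

sumOver-seqs-stepsOK : ∀ n m p (f : List ℕ → ℕ) → p + n < m →
                       ∑[ s ∈ seqs n m ] (ind (stepsOK p s) * f s) ≡ sumContinuations p n f
sumOver-seqs-stepsOK zero    m p f _ = trans (+-identityʳ _) (+-identityʳ (f []))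
sumOver-seqs-stepsOK (suc n) m p f p+1+n<m = begin
  ∑[ s ∈ seqs (suc n) m ] (ind (stepsOK p s) * f s)
    ≡⟨ sumOver-seqs-suc n m _ ⟩
  ∑[ v < m ] ∑[ s ∈ seqs n m ] (ind ((v ≤ᵇ suc p) ∧ stepsOK v s) * f (v ∷ s))
    ≡⟨ sumBelow-cong m (λ v → factor v) ⟩
  ∑[ v < m ] (ind (v ≤ᵇ suc p) * ∑[ s ∈ seqs n m ] (ind (stepsOK v s) * f (v ∷ s)))
    ≡⟨ sumBelow-≤ᵇ (suc p) m _ (≤-<-trans (m≤m+n (suc p) n) 1+p+n<m) ⟩
  ∑[ v < 2 + p ] ∑[ s ∈ seqs n m ] (ind (stepsOK v s) * f (v ∷ s))
    ≡⟨ sumBelow-cong< (2 + p) (λ v v<2+p → sumOver-seqs-stepsOK n m v (λ s → f (v ∷ s))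
                                               (≤-<-trans (+-monoˡ-≤ n (s≤s⁻¹ v<2+p)) 1+p+n<m)) ⟩
  sumContinuations p (suc n) f ∎
  where
  1+p+n<m : suc p + n < m
  1+p+n<m = subst (_< m) (+-suc p n) p+1+n<m

  factor : ∀ v → ∑[ s ∈ seqs n m ] (ind ((v ≤ᵇ suc p) ∧ stepsOK v s) * f (v ∷ s))
               ≡ ind (v ≤ᵇ suc p) * ∑[ s ∈ seqs n m ] (ind (stepsOK v s) * f (v ∷ s))
  factor v = trans (sumOver-cong (λ s → ind-∧ (v ≤ᵇ suc p) (stepsOK v s) (f (v ∷ s))) (seqs n m))
                   (sumOver-*ˡ (ind (v ≤ᵇ suc p)) _ (seqs n m))

sumOver-catalanWords : ∀ n (f : List ℕ → ℕ) →
                       sumOver f (catalanWords (suc n)) ≡ sumContinuations 0 n (λ s → f (0 ∷ s))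
sumOver-catalanWords n f = begin
  sumOver f (catalanWords (suc n))
    ≡⟨ sumOver-filter isCatalan f (seqs (suc n) (suc n)) ⟩
  ∑[ w ∈ seqs (suc n) (suc n) ] (ind (isCatalan w) * f w)
    ≡⟨ sumOver-seqs-suc n (suc n) _ ⟩
  ∑[ s ∈ seqs n (suc n) ] (ind (stepsOK 0 s) * f (0 ∷ s)) + ∑[ v < n ] ∑[ s ∈ seqs n (suc n) ] 0
    ≡⟨ cong (∑[ s ∈ seqs n (suc n) ] (ind (stepsOK 0 s) * f (0 ∷ s)) +_)
            (trans (sumBelow-cong n (λ _ → sumOver-zero (seqs n (suc n)))) (sumBelow-zero n)) ⟩
  ∑[ s ∈ seqs n (suc n) ] (ind (stepsOK 0 s) * f (0 ∷ s)) + 0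
    ≡⟨ +-identityʳ _ ⟩
  ∑[ s ∈ seqs n (suc n) ] (ind (stepsOK 0 s) * f (0 ∷ s))
    ≡⟨ sumOver-seqs-stepsOK n (suc n) 0 (λ s → f (0 ∷ s)) (n<1+n n) ⟩
  sumContinuations 0 n (λ s → f (0 ∷ s)) ∎

sumContinuations-snoc : ∀ p n (f : List ℕ → ℕ) →
  sumContinuations p (suc n) f
    ≡ sumContinuations p n (λ s → ∑[ h < suc (lastCol (p ∷ s)) ] f (s ++ h ∷ []))
sumContinuations-snoc p zero    f = refl
sumContinuations-snoc p (suc n) f =
  sumBelow-cong (2 + p) (λ v → sumContinuations-snoc v n (λ s → f (v ∷ s)))

sumContinuations-cong : ∀ p n {f g : List ℕ → ℕ} → (∀ s → length s ≡ n → f s ≡ g s) →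
                        sumContinuations p n f ≡ sumContinuations p n g
sumContinuations-cong p zero    f≗g = f≗g [] refl
sumContinuations-cong p (suc n) f≗g =
  sumBelow-cong (2 + p) (λ v → sumContinuations-cong v n (λ s len → f≗g (v ∷ s) (cong suc len)))

sumOver-catalanWords-snoc : ∀ n (f : List ℕ → ℕ) →
  sumOver f (catalanWords (2 + n))
    ≡ ∑[ w ∈ catalanWords (suc n) ] ∑[ h < suc (lastCol w) ] f (w ++ h ∷ [])
sumOver-catalanWords-snoc n f =
  trans (sumOver-catalanWords (suc n) f)
        (trans (sumContinuations-snoc 0 n (λ s → f (0 ∷ s)))
               (sym (sumOver-catalanWords n (λ w → ∑[ h < suc (lastCol w) ] f (w ++ h ∷ [])))))

sumOver-catalanWords-cong : ∀ n {f g : List ℕ → ℕ} → (∀ w → length w ≡ n → f w ≡ g w) →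
                            sumOver f (catalanWords n) ≡ sumOver g (catalanWords n)
sumOver-catalanWords-cong zero    _   = refl
sumOver-catalanWords-cong (suc n) f≗g =
  trans (sumOver-catalanWords n _)
        (trans (sumContinuations-cong 0 n (λ s len → f≗g (0 ∷ s) (cong suc len)))
               (sym (sumOver-catalanWords n _)))

sumOver-telescope : ∀ (G : List ℕ → ℕ → ℕ) ws →
  ∑[ w ∈ ws ] ∑[ h < suc (lastCol w) ] G w (suc h) + ∑[ w ∈ ws ] G w 0
    ≡ ∑[ w ∈ ws ] G w (suc (lastCol w)) + ∑[ w ∈ ws ] ∑[ h < suc (lastCol w) ] G w h
sumOver-telescope G ws = begin
  ∑[ w ∈ ws ] ∑[ h < suc (lastCol w) ] G w (suc h) + ∑[ w ∈ ws ] G w 0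
    ≡⟨ sumOver-+ _ _ ws ⟨
  ∑[ w ∈ ws ] (∑[ h < suc (lastCol w) ] G w (suc h) + G w 0)
    ≡⟨ sumOver-cong (λ w → sumBelow-telescope (suc (lastCol w)) (G w)) ws ⟩
  ∑[ w ∈ ws ] (G w (suc (lastCol w)) + ∑[ h < suc (lastCol w) ] G w h)
    ≡⟨ sumOver-+ _ _ ws ⟩
  ∑[ w ∈ ws ] G w (suc (lastCol w)) + ∑[ w ∈ ws ] ∑[ h < suc (lastCol w) ] G w h ∎

-- Exponent vectors and weights

-- A monomial y^a z^b u^c is represented by (a , b , c): ⊞ multiplies monomials and e ⊠ t is e^t.
Exponents : Set
Exponents = ℕ × ℕ × ℕ

infixl 6 _⊞_
infixl 7 _⊠_
infix  4 _≡³ᵇ_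

_⊞_ : Exponents → Exponents → Exponents
(a , b , c) ⊞ (a' , b' , c') = a + a' , b + b' , c + c'

_⊠_ : Exponents → ℕ → Exponents
(a , b , c) ⊠ t = a * t , b * t , c * t

0ₑ : Exponents
0ₑ = 0 , 0 , 0

_≡³ᵇ_ : Exponents → Exponents → Bool
(a , b , c) ≡³ᵇ (a' , b' , c') = (a ≡ᵇ a') ∧ (b ≡ᵇ b') ∧ (c ≡ᵇ c')

⊞-assoc : ∀ e f g → (e ⊞ f) ⊞ g ≡ e ⊞ (f ⊞ g)
⊞-assoc (a , b , c) (a' , b' , c') (a'' , b'' , c'') =
  cong₂ _,_ (+-assoc a a' a'') (cong₂ _,_ (+-assoc b b' b'') (+-assoc c c' c''))

⊞-comm : ∀ e f → e ⊞ f ≡ f ⊞ e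
⊞-comm (a , b , c) (a' , b' , c') = cong₂ _,_ (+-comm a a') (cong₂ _,_ (+-comm b b') (+-comm c c'))

⊠-zeroʳ : ∀ e → e ⊠ 0 ≡ 0ₑ
⊠-zeroʳ (a , b , c) = cong₂ _,_ (*-zeroʳ a) (cong₂ _,_ (*-zeroʳ b) (*-zeroʳ c))

⊠-suc : ∀ e t → e ⊠ suc t ≡ e ⊞ e ⊠ t
⊠-suc (a , b , c) t = cong₂ _,_ (*-suc a t) (cong₂ _,_ (*-suc b t) (*-suc c t))

⊠-distribʳ-⊞ : ∀ t e f → (e ⊞ f) ⊠ t ≡ e ⊠ t ⊞ f ⊠ t
⊠-distribʳ-⊞ t (a , b , c) (a' , b' , c') =
  cong₂ _,_ (*-distribʳ-+ t a a') (cong₂ _,_ (*-distribʳ-+ t b b') (*-distribʳ-+ t c c'))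

⊞-⊠-suc : ∀ μ e t → μ ⊞ (e ⊞ μ ⊠ t) ≡ e ⊞ μ ⊠ suc t
⊞-⊠-suc μ e t = begin
  μ ⊞ (e ⊞ μ ⊠ t)   ≡⟨ ⊞-assoc μ e (μ ⊠ t) ⟨
  (μ ⊞ e) ⊞ μ ⊠ t   ≡⟨ cong (_⊞ μ ⊠ t) (⊞-comm μ e) ⟩
  (e ⊞ μ) ⊞ μ ⊠ t   ≡⟨ ⊞-assoc e μ (μ ⊠ t) ⟩
  e ⊞ (μ ⊞ μ ⊠ t)   ≡⟨ cong (e ⊞_) (⊠-suc μ t) ⟨
  e ⊞ μ ⊠ suc t     ∎

base : List ℕ → Exponents
base w = ver w , white w , 0

weight : Exponents → List ℕ → Exponents
weight σ w = base w ⊞ σ ⊠ lastCol w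

-- One cell of a column of even (true) or odd (false) index contributes z resp. y.
cell : Bool → Exponents
cell true  = 0 , 1 , 0
cell false = 1 , 0 , 0

ratio : Bool → Exponents → Exponents
ratio par σ = cell par ⊞ σ

base-snoc : ∀ w h → base (w ++ h ∷ []) ≡ base w ⊞ cell (isEven (suc (length w))) ⊠ suc h
base-snoc []           h = refl
base-snoc (x ∷ [])     h = cong (_, suc h + 0 , 0) (sym (+-identityʳ (suc x + 0)))
base-snoc (x ∷ y ∷ ws) h = begin
  (suc x , suc y , 0) ⊞ base (ws ++ h ∷ [])     ≡⟨ cong ((suc x , suc y , 0) ⊞_) (base-snoc ws h) ⟩
  (suc x , suc y , 0) ⊞ (base ws ⊞ c ⊠ suc h)   ≡⟨ ⊞-assoc (suc x , suc y , 0) (base ws) (c ⊠ suc h) ⟨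
  (suc x , suc y , 0) ⊞ base ws ⊞ c ⊠ suc h     ∎
  where c = cell (isEven (suc (length ws)))

lastCol-snoc : ∀ w h → lastCol (w ++ h ∷ []) ≡ suc h
lastCol-snoc []           h = refl
lastCol-snoc (x ∷ [])     h = refl
lastCol-snoc (x ∷ y ∷ ws) h = lastCol-snoc (y ∷ ws) h

weight-snoc : ∀ σ w h → weight σ (w ++ h ∷ []) ≡ base w ⊞ ratio (isEven (suc (length w))) σ ⊠ suc h
weight-snoc σ w h = begin
  base (w ++ h ∷ []) ⊞ σ ⊠ lastCol (w ++ h ∷ [])
    ≡⟨ cong₂ (λ e t → e ⊞ σ ⊠ t) (base-snoc w h) (lastCol-snoc w h) ⟩
  (base w ⊞ c ⊠ suc h) ⊞ σ ⊠ suc h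
    ≡⟨ ⊞-assoc (base w) (c ⊠ suc h) (σ ⊠ suc h) ⟩
  base w ⊞ (c ⊠ suc h ⊞ σ ⊠ suc h)
    ≡⟨ cong (base w ⊞_) (⊠-distribʳ-⊞ (suc h) c σ) ⟨
  base w ⊞ (c ⊞ σ) ⊠ suc h ∎
  where c = cell (isEven (suc (length w)))

-- Telescoping over the appended column

count-telescope : ∀ par σ m abc → isEven m ≡ par → let μ = ratio par σ in
  count (λ w → μ ⊞ weight σ w ≡³ᵇ abc) (catalanWords (2 + m))
    + count (λ w → μ ⊞ weight 0ₑ w ≡³ᵇ abc) (catalanWords (suc m))
  ≡ count (λ w → μ ⊞ μ ⊞ weight μ w ≡³ᵇ abc) (catalanWords (suc m))
    + count (λ w → weight σ w ≡³ᵇ abc) (catalanWords (2 + m))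
count-telescope par σ m abc isEven-m = begin
  count (λ w → μ ⊞ weight σ w ≡³ᵇ abc) (catalanWords (2 + m))
    + count (λ w → μ ⊞ weight 0ₑ w ≡³ᵇ abc) (catalanWords (suc m))
    ≡⟨ cong₂ _+_ (extended (λ w → μ ⊞ weight σ w) (λ w h → G w (suc h))
                           (λ w h len → cong hits (μ-weight-snoc w h len)))
                 (unextended (λ w → μ ⊞ weight 0ₑ w) (λ w → G w 0) (λ w → cong hits (μ-weight-0ₑ w))) ⟩
  ∑[ w ∈ catalanWords (suc m) ] ∑[ h < suc (lastCol w) ] G w (suc h)
    + ∑[ w ∈ catalanWords (suc m) ] G w 0
    ≡⟨ sumOver-telescope G (catalanWords (suc m)) ⟩
  ∑[ w ∈ catalanWords (suc m) ] G w (suc (lastCol w))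
    + ∑[ w ∈ catalanWords (suc m) ] ∑[ h < suc (lastCol w) ] G w h
    ≡⟨ cong₂ _+_ (unextended (λ w → μ ⊞ μ ⊞ weight μ w) (λ w → G w (suc (lastCol w)))
                             (λ w → cong hits (μμ-weight-μ w)))
                 (extended (weight σ) G (λ w h len → cong hits (weight-snoc′ w h len))) ⟨
  count (λ w → μ ⊞ μ ⊞ weight μ w ≡³ᵇ abc) (catalanWords (suc m))
    + count (λ w → weight σ w ≡³ᵇ abc) (catalanWords (2 + m)) ∎
  where
  μ = ratio par σ

  hits : Exponents → ℕ
  hits e = ind (e ≡³ᵇ abc)

  -- the test of the weight of w extended by a column of height t + 1
  G : List ℕ → ℕ → ℕ
  G w t = hits (base w ⊞ μ ⊠ suc t)

  weight-snoc′ : ∀ w h → length w ≡ suc m → weight σ (w ++ h ∷ []) ≡ base w ⊞ μ ⊠ suc h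
  weight-snoc′ w h len = trans (weight-snoc σ w h)
    (cong (λ b → base w ⊞ ratio b σ ⊠ suc h) (trans (cong (isEven ∘ suc) len) isEven-m))

  μ-weight-snoc : ∀ w h → length w ≡ suc m → μ ⊞ weight σ (w ++ h ∷ []) ≡ base w ⊞ μ ⊠ suc (suc h)
  μ-weight-snoc w h len = trans (cong (μ ⊞_) (weight-snoc′ w h len)) (⊞-⊠-suc μ (base w) (suc h))

  μ-weight-0ₑ : ∀ w → μ ⊞ weight 0ₑ w ≡ base w ⊞ μ ⊠ 1
  μ-weight-0ₑ w = trans (cong (λ e → μ ⊞ (base w ⊞ e)) (sym (⊠-zeroʳ μ))) (⊞-⊠-suc μ (base w) 0)

  μμ-weight-μ : ∀ w → μ ⊞ μ ⊞ weight μ w ≡ base w ⊞ μ ⊠ suc (suc (lastCol w))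
  μμ-weight-μ w = begin
    μ ⊞ μ ⊞ (base w ⊞ μ ⊠ lastCol w)     ≡⟨ ⊞-assoc μ μ _ ⟩
    μ ⊞ (μ ⊞ (base w ⊞ μ ⊠ lastCol w))   ≡⟨ cong (μ ⊞_) (⊞-⊠-suc μ (base w) (lastCol w)) ⟩
    μ ⊞ (base w ⊞ μ ⊠ suc (lastCol w))   ≡⟨ ⊞-⊠-suc μ (base w) (suc (lastCol w)) ⟩
    base w ⊞ μ ⊠ suc (suc (lastCol w))   ∎

  extended : ∀ (e : List ℕ → Exponents) (g : List ℕ → ℕ → ℕ) →
             (∀ w h → length w ≡ suc m → hits (e (w ++ h ∷ [])) ≡ g w h) →
             count (λ w → e w ≡³ᵇ abc) (catalanWords (2 + m))
               ≡ ∑[ w ∈ catalanWords (suc m) ] ∑[ h < suc (lastCol w) ] g w h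
  extended e g hits≡g =
    trans (count≡sumOver (λ w → e w ≡³ᵇ abc) (catalanWords (2 + m)))
          (trans (sumOver-catalanWords-snoc m (hits ∘ e))
                 (sumOver-catalanWords-cong (suc m)
                    (λ w len → sumBelow-cong (suc (lastCol w)) (λ h → hits≡g w h len))))

  unextended : ∀ (e : List ℕ → Exponents) (g : List ℕ → ℕ) → (∀ w → hits (e w) ≡ g w) →
               count (λ w → e w ≡³ᵇ abc) (catalanWords (suc m)) ≡ ∑[ w ∈ catalanWords (suc m) ] g w
  unextended e g hits≡g =
    trans (count≡sumOver (λ w → e w ≡³ᵇ abc) (catalanWords (suc m)))
          (sumOver-cong hits≡g (catalanWords (suc m)))

-- Multiplication by monomials and polynomials

coeffAt : Series → Maybe ℕ → Maybe ℕ → Maybe ℕ → Maybe ℕ → ℤ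
coeffAt F (just n) (just a) (just b) (just c) = F n a b c
coeffAt F _        _        _        _        = ℤ.+ 0

monoMul-coeffAt : ∀ p q r s F n a b c →
                  monoMul p q r s F n a b c ≡ coeffAt F (n -? p) (a -? q) (b -? r) (c -? s)
monoMul-coeffAt p q r s F n a b c with n -? p | a -? q | b -? r | c -? s
... | nothing | _       | _       | _       = refl
... | just _  | nothing | _       | _       = refl
... | just _  | just _  | nothing | _       = refl
... | just _  | just _  | just _  | nothing = refl
... | just _  | just _  | just _  | just _  = refl

coeffAt-cong : ∀ {F G} → F ≋ G → ∀ x y z w → coeffAt F x y z w ≡ coeffAt G x y z w
coeffAt-cong F≋G (just n) (just a) (just b) (just c) = F≋G n a b c
coeffAt-cong F≋G nothing  _        _        _        = refl
coeffAt-cong F≋G (just _) nothing  _        _        = refl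
coeffAt-cong F≋G (just _) (just _) nothing  _        = refl
coeffAt-cong F≋G (just _) (just _) (just _) nothing  = refl

coeffAt-pointwise : ∀ (f : ℤ → ℤ → ℤ) → f (ℤ.+ 0) (ℤ.+ 0) ≡ ℤ.+ 0 → ∀ F G x y z w →
  coeffAt (λ n a b c → f (F n a b c) (G n a b c)) x y z w ≡ f (coeffAt F x y z w) (coeffAt G x y z w)
coeffAt-pointwise f f00 F G (just n) (just a) (just b) (just c) = refl
coeffAt-pointwise f f00 F G nothing  _        _        _        = sym f00
coeffAt-pointwise f f00 F G (just _) nothing  _        _        = sym f00
coeffAt-pointwise f f00 F G (just _) (just _) nothing  _        = sym f00
coeffAt-pointwise f f00 F G (just _) (just _) (just _) nothing  = sym f00

coeffAt-nothing₂ : ∀ F x z w → coeffAt F x nothing z w ≡ ℤ.+ 0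
coeffAt-nothing₂ F nothing  z w = refl
coeffAt-nothing₂ F (just _) z w = refl

coeffAt-nothing₃ : ∀ F x y w → coeffAt F x y nothing w ≡ ℤ.+ 0
coeffAt-nothing₃ F nothing  y        w = refl
coeffAt-nothing₃ F (just _) nothing  w = refl
coeffAt-nothing₃ F (just _) (just _) w = refl

coeffAt-nothing₄ : ∀ F x y z → coeffAt F x y z nothing ≡ ℤ.+ 0
coeffAt-nothing₄ F nothing  y        z        = refl
coeffAt-nothing₄ F (just _) nothing  z        = refl
coeffAt-nothing₄ F (just _) (just _) nothing  = refl
coeffAt-nothing₄ F (just _) (just _) (just _) = refl

coeffAt-bind : ∀ p q r s (F : Series) (x y z w : Maybe ℕ) →
  coeffAt (λ n a b c → coeffAt F (n -? p) (a -? q) (b -? r) (c -? s)) x y z w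
    ≡ coeffAt F (x >>= (_-? p)) (y >>= (_-? q)) (z >>= (_-? r)) (w >>= (_-? s))
coeffAt-bind p q r s F nothing  _        _        _        = refl
coeffAt-bind p q r s F (just n) nothing  _        _        = sym (coeffAt-nothing₂ F (n -? p) _ _)
coeffAt-bind p q r s F (just n) (just a) nothing  _        = sym (coeffAt-nothing₃ F (n -? p) (a -? q) _)
coeffAt-bind p q r s F (just n) (just a) (just b) nothing  = sym (coeffAt-nothing₄ F (n -? p) (a -? q) (b -? r))
coeffAt-bind p q r s F (just n) (just a) (just b) (just c) = refl

-?-+ : ∀ n p p' → n -? (p + p') ≡ ((n -? p) >>= (_-? p'))
-?-+ n       zero    p' = refl
-?-+ zero    (suc p) p' = refl
-?-+ (suc n) (suc p) p' = -?-+ n p p'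

monoMul-cong : ∀ p q r s {F G} → F ≋ G → monoMul p q r s F ≋ monoMul p q r s G
monoMul-cong p q r s {F} {G} F≋G n a b c = begin
  monoMul p q r s F n a b c                       ≡⟨ monoMul-coeffAt p q r s F n a b c ⟩
  coeffAt F (n -? p) (a -? q) (b -? r) (c -? s)   ≡⟨ coeffAt-cong F≋G (n -? p) (a -? q) (b -? r) (c -? s) ⟩
  coeffAt G (n -? p) (a -? q) (b -? r) (c -? s)   ≡⟨ monoMul-coeffAt p q r s G n a b c ⟨
  monoMul p q r s G n a b c                       ∎

monoMul-pointwise : ∀ p q r s (f : ℤ → ℤ → ℤ) → f (ℤ.+ 0) (ℤ.+ 0) ≡ ℤ.+ 0 → ∀ F G n a b c →
  monoMul p q r s (λ n a b c → f (F n a b c) (G n a b c)) n a b c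
    ≡ f (monoMul p q r s F n a b c) (monoMul p q r s G n a b c)
monoMul-pointwise p q r s f f00 F G n a b c = begin
  monoMul p q r s (λ n a b c → f (F n a b c) (G n a b c)) n a b c
    ≡⟨ monoMul-coeffAt p q r s _ n a b c ⟩
  coeffAt (λ n a b c → f (F n a b c) (G n a b c)) (n -? p) (a -? q) (b -? r) (c -? s)
    ≡⟨ coeffAt-pointwise f f00 F G (n -? p) (a -? q) (b -? r) (c -? s) ⟩
  f (coeffAt F (n -? p) (a -? q) (b -? r) (c -? s)) (coeffAt G (n -? p) (a -? q) (b -? r) (c -? s))
    ≡⟨ cong₂ f (monoMul-coeffAt p q r s F n a b c) (monoMul-coeffAt p q r s G n a b c) ⟨
  f (monoMul p q r s F n a b c) (monoMul p q r s G n a b c) ∎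

monoMul-monoMul : ∀ p q r s p' q' r' s' F →
  monoMul p q r s (monoMul p' q' r' s' F) ≋ monoMul (p + p') (q + q') (r + r') (s + s') F
monoMul-monoMul p q r s p' q' r' s' F n a b c = begin
  monoMul p q r s (monoMul p' q' r' s' F) n a b c
    ≡⟨ monoMul-coeffAt p q r s _ n a b c ⟩
  coeffAt (monoMul p' q' r' s' F) (n -? p) (a -? q) (b -? r) (c -? s)
    ≡⟨ coeffAt-cong (monoMul-coeffAt p' q' r' s' F) (n -? p) (a -? q) (b -? r) (c -? s) ⟩
  coeffAt (λ n a b c → coeffAt F (n -? p') (a -? q') (b -? r') (c -? s')) (n -? p) (a -? q) (b -? r) (c -? s)
    ≡⟨ coeffAt-bind p' q' r' s' F (n -? p) (a -? q) (b -? r) (c -? s) ⟩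
  coeffAt F ((n -? p) >>= (_-? p')) ((a -? q) >>= (_-? q')) ((b -? r) >>= (_-? r')) ((c -? s) >>= (_-? s'))
    ≡⟨ cong₂ (λ (x , y) (z , w) → coeffAt F x y z w)
             (cong₂ _,_ (-?-+ n p p') (-?-+ a q q')) (cong₂ _,_ (-?-+ b r r') (-?-+ c s s')) ⟨
  coeffAt F (n -? (p + p')) (a -? (q + q')) (b -? (r + r')) (c -? (s + s'))
    ≡⟨ monoMul-coeffAt (p + p') (q + q') (r + r') (s + s') F n a b c ⟨
  monoMul (p + p') (q + q') (r + r') (s + s') F n a b c ∎

monoMul-comm : ∀ p q r s p' q' r' s' F →
  monoMul p q r s (monoMul p' q' r' s' F) ≋ monoMul p' q' r' s' (monoMul p q r s F)
monoMul-comm p q r s p' q' r' s' F n a b c = begin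
  monoMul p q r s (monoMul p' q' r' s' F) n a b c
    ≡⟨ monoMul-monoMul p q r s p' q' r' s' F n a b c ⟩
  monoMul (p + p') (q + q') (r + r') (s + s') F n a b c
    ≡⟨ cong₂ (λ (x , y) (z , w) → monoMul x y z w F n a b c)
             (cong₂ _,_ (+-comm p p') (+-comm q q')) (cong₂ _,_ (+-comm r r') (+-comm s s')) ⟩
  monoMul (p' + p) (q' + q) (r' + r) (s' + s) F n a b c
    ≡⟨ monoMul-monoMul p' q' r' s' p q r s F n a b c ⟨
  monoMul p' q' r' s' (monoMul p q r s F) n a b c ∎

0ₛ : Series
0ₛ _ _ _ _ = ℤ.+ 0

scale : ℤ → Series → Series
scale k F n a b c = k *ℤ F n a b c

monoMul-⊕ : ∀ p q r s F G n a b c →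
  monoMul p q r s (F ⊕ G) n a b c ≡ monoMul p q r s F n a b c +ℤ monoMul p q r s G n a b c
monoMul-⊕ p q r s = monoMul-pointwise p q r s _+ℤ_ refl

monoMul-scale : ∀ p q r s k F n a b c →
  monoMul p q r s (scale k F) n a b c ≡ k *ℤ monoMul p q r s F n a b c
monoMul-scale p q r s k F = monoMul-pointwise p q r s (λ x _ → k *ℤ x) (ℤP.*-zeroʳ k) F F

monoMul-zero : ∀ p q r s → monoMul p q r s 0ₛ ≋ 0ₛ
monoMul-zero p q r s = monoMul-pointwise p q r s (λ _ _ → ℤ.+ 0) refl 0ₛ 0ₛ

·-cong : ∀ P {F G} → F ≋ G → P · F ≋ P · G
·-cong []                   F≋G n a b c = refl
·-cong (term k p q r s ∷ P) F≋G n a b c =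
  cong₂ (λ x y → k *ℤ x +ℤ y) (monoMul-cong p q r s F≋G n a b c) (·-cong P F≋G n a b c)

·-⊕ : ∀ P F G → P · (F ⊕ G) ≋ P · F ⊕ P · G
·-⊕ []                   F G n a b c = refl
·-⊕ (term k p q r s ∷ P) F G n a b c =
  trans (cong₂ (λ x y → k *ℤ x +ℤ y) (monoMul-⊕ p q r s F G n a b c) (·-⊕ P F G n a b c))
        (distrib k _ _ _ _)
  where
  distrib : ∀ k x y u v → k *ℤ (x +ℤ y) +ℤ (u +ℤ v) ≡ (k *ℤ x +ℤ u) +ℤ (k *ℤ y +ℤ v)
  distrib = ℤ-Solver.solve-∀

·-⊖ : ∀ P F → P · (⊖ F) ≋ ⊖ (P · F)
·-⊖ []                   F n a b c = refl
·-⊖ (term k p q r s ∷ P) F n a b c =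
  trans (cong₂ (λ x y → k *ℤ x +ℤ y) (monoMul-pointwise p q r s (λ x _ → -ℤ x) refl F F n a b c)
                                      (·-⊖ P F n a b c))
        (distrib k _ _)
  where
  distrib : ∀ k x u → k *ℤ (-ℤ x) +ℤ (-ℤ u) ≡ -ℤ (k *ℤ x +ℤ u)
  distrib = ℤ-Solver.solve-∀

·-scale : ∀ P k F → P · scale k F ≋ scale k (P · F)
·-scale []                    k F n a b c = sym (ℤP.*-zeroʳ k)
·-scale (term k' p q r s ∷ P) k F n a b c =
  trans (cong₂ (λ x y → k' *ℤ x +ℤ y) (monoMul-scale p q r s k F n a b c) (·-scale P k F n a b c))
        (distrib k k' _ _)
  where
  distrib : ∀ k k' x u → k' *ℤ (k *ℤ x) +ℤ k *ℤ u ≡ k *ℤ (k' *ℤ x +ℤ u)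
  distrib = ℤ-Solver.solve-∀

·-zero : ∀ P → P · 0ₛ ≋ 0ₛ
·-zero []                   n a b c = refl
·-zero (term k p q r s ∷ P) n a b c =
  trans (cong₂ (λ x y → k *ℤ x +ℤ y) (monoMul-zero p q r s n a b c) (·-zero P n a b c))
        (cong (_+ℤ ℤ.+ 0) (ℤP.*-zeroʳ k))

·-++ : ∀ P Q F → (P ++ Q) · F ≋ P · F ⊕ Q · F
·-++ []                   Q F n a b c = sym (ℤP.+-identityˡ _)
·-++ (term k p q r s ∷ P) Q F n a b c =
  trans (cong (k *ℤ monoMul p q r s F n a b c +ℤ_) (·-++ P Q F n a b c))
        (sym (ℤP.+-assoc (k *ℤ monoMul p q r s F n a b c) _ _))

-- the product of terms used by _*ₚ_, so that (t ∷ P) *ₚ Q reduces to map (termMul t) Q ++ P *ₚ Q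
termMul : Term → Term → Term
termMul (term k p q r s) (term l p' q' r' s') = term (k *ℤ l) (p + p') (q + q') (r + r') (s + s')

·-map-termMul : ∀ k p q r s Q F →
  map (termMul (term k p q r s)) Q · F ≋ scale k (monoMul p q r s (Q · F))
·-map-termMul k p q r s []                       F n a b c =
  sym (trans (cong (k *ℤ_) (monoMul-zero p q r s n a b c)) (ℤP.*-zeroʳ k))
·-map-termMul k p q r s (term l p' q' r' s' ∷ Q) F n a b c = begin
  (k *ℤ l) *ℤ monoMul (p + p') (q + q') (r + r') (s + s') F n a b c
    +ℤ (map (termMul (term k p q r s)) Q · F) n a b c
    ≡⟨ cong₂ (λ x y → (k *ℤ l) *ℤ x +ℤ y) (sym (monoMul-monoMul p q r s p' q' r' s' F n a b c))
             (·-map-termMul k p q r s Q F n a b c) ⟩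
  (k *ℤ l) *ℤ monoMul p q r s G n a b c +ℤ k *ℤ monoMul p q r s (Q · F) n a b c
    ≡⟨ distrib k l _ _ ⟩
  k *ℤ (l *ℤ monoMul p q r s G n a b c +ℤ monoMul p q r s (Q · F) n a b c)
    ≡⟨ cong (λ x → k *ℤ (x +ℤ monoMul p q r s (Q · F) n a b c)) (monoMul-scale p q r s l G n a b c) ⟨
  k *ℤ (monoMul p q r s (scale l G) n a b c +ℤ monoMul p q r s (Q · F) n a b c)
    ≡⟨ cong (k *ℤ_) (monoMul-⊕ p q r s (scale l G) (Q · F) n a b c) ⟨
  k *ℤ monoMul p q r s ((term l p' q' r' s' ∷ Q) · F) n a b c ∎
  where
  G = monoMul p' q' r' s' F
  distrib : ∀ k l x u → (k *ℤ l) *ℤ x +ℤ k *ℤ u ≡ k *ℤ (l *ℤ x +ℤ u)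
  distrib = ℤ-Solver.solve-∀

*ₚ-· : ∀ P Q F → (P *ₚ Q) · F ≋ P · (Q · F)
*ₚ-· []                   Q F n a b c = refl
*ₚ-· (term k p q r s ∷ P) Q F n a b c =
  trans (·-++ (map (termMul (term k p q r s)) Q) (P *ₚ Q) F n a b c)
        (cong₂ _+ℤ_ (·-map-termMul k p q r s Q F n a b c) (*ₚ-· P Q F n a b c))

monoMul-· : ∀ p q r s Q F → monoMul p q r s (Q · F) ≋ Q · monoMul p q r s F
monoMul-· p q r s []                       F = monoMul-zero p q r s
monoMul-· p q r s (term l p' q' r' s' ∷ Q) F n a b c = begin
  monoMul p q r s (scale l (monoMul p' q' r' s' F) ⊕ Q · F) n a b c
    ≡⟨ monoMul-⊕ p q r s _ (Q · F) n a b c ⟩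
  monoMul p q r s (scale l (monoMul p' q' r' s' F)) n a b c +ℤ monoMul p q r s (Q · F) n a b c
    ≡⟨ cong₂ _+ℤ_ (monoMul-scale p q r s l _ n a b c) (monoMul-· p q r s Q F n a b c) ⟩
  l *ℤ monoMul p q r s (monoMul p' q' r' s' F) n a b c +ℤ (Q · monoMul p q r s F) n a b c
    ≡⟨ cong (λ x → l *ℤ x +ℤ (Q · monoMul p q r s F) n a b c)
            (monoMul-comm p q r s p' q' r' s' F n a b c) ⟩
  l *ℤ monoMul p' q' r' s' (monoMul p q r s F) n a b c +ℤ (Q · monoMul p q r s F) n a b c ∎

·-comm : ∀ P Q F → P · (Q · F) ≋ Q · (P · F)
·-comm []                   Q F n a b c = sym (·-zero Q n a b c)
·-comm (term k p q r s ∷ P) Q F n a b c = begin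
  k *ℤ monoMul p q r s (Q · F) n a b c +ℤ (P · (Q · F)) n a b c
    ≡⟨ cong₂ (λ x y → k *ℤ x +ℤ y) (monoMul-· p q r s Q F n a b c) (·-comm P Q F n a b c) ⟩
  k *ℤ (Q · monoMul p q r s F) n a b c +ℤ (Q · (P · F)) n a b c
    ≡⟨ cong (_+ℤ (Q · (P · F)) n a b c) (·-scale Q k (monoMul p q r s F) n a b c) ⟨
  (Q · scale k (monoMul p q r s F)) n a b c +ℤ (Q · (P · F)) n a b c
    ≡⟨ ·-⊕ Q (scale k (monoMul p q r s F)) (P · F) n a b c ⟨
  (Q · (scale k (monoMul p q r s F) ⊕ P · F)) n a b c ∎

mono-· : ∀ p q r s F n a b c → (mono p q r s · F) n a b c ≡ monoMul p q r s F n a b c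
mono-· p q r s F n a b c = unit (monoMul p q r s F n a b c)
  where
  unit : ∀ x → ℤ.+ 1 *ℤ x +ℤ ℤ.+ 0 ≡ x
  unit = ℤ-Solver.solve-∀

binomial-· : ∀ p q r s p' q' r' s' F n a b c →
  ((mono p q r s -ₚ mono p' q' r' s') · F) n a b c
    ≡ monoMul p q r s F n a b c -ℤ monoMul p' q' r' s' F n a b c
binomial-· p q r s p' q' r' s' F n a b c =
  difference (monoMul p q r s F n a b c) (monoMul p' q' r' s' F n a b c)
  where
  difference : ∀ x y → ℤ.+ 1 *ℤ x +ℤ (-[1+ 0 ] *ℤ y +ℤ ℤ.+ 0) ≡ x -ℤ y
  difference = ℤ-Solver.solve-∀

eliminate : ∀ A B m {F G R S} → A · F ≋ m · G ⊕ R → B · G ≋ S → (A *ₚ B) · F ≋ m · S ⊕ B · R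
eliminate A B m {F} {G} {R} {S} A·F≋ B·G≋ n a b c = begin
  ((A *ₚ B) · F) n a b c                         ≡⟨ *ₚ-· A B F n a b c ⟩
  (A · (B · F)) n a b c                          ≡⟨ ·-comm A B F n a b c ⟩
  (B · (A · F)) n a b c                          ≡⟨ ·-cong B A·F≋ n a b c ⟩
  (B · (m · G ⊕ R)) n a b c                      ≡⟨ ·-⊕ B (m · G) R n a b c ⟩
  (B · (m · G)) n a b c +ℤ (B · R) n a b c       ≡⟨ cong (_+ℤ (B · R) n a b c) (·-comm B m G n a b c) ⟩
  (m · (B · G)) n a b c +ℤ (B · R) n a b c       ≡⟨ cong (_+ℤ (B · R) n a b c) (·-cong m B·G≋ n a b c) ⟩
  (m · S) n a b c +ℤ (B · R) n a b c             ∎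

·-·-swap : ∀ P Q F → P · (Q · F) ≋ (Q *ₚ P) · F
·-·-swap P Q F n a b c = trans (·-comm P Q F n a b c) (sym (*ₚ-· Q P F n a b c))

-- Series given by counting

-- C n P counts the objects of size n whose exponent vector satisfies P; series C is their generating function.
Counting : Set
Counting = ℕ → (Exponents → Bool) → ℤ

series : Counting → Series
series C n a b c = C n (_≡³ᵇ (a , b , c))

shiftBy : Exponents → Counting → Counting
shiftBy e C n P = C n (λ e' → P (e ⊞ e'))

record IsCounting (C : Counting) : Set where
  field
    pred-cong  : ∀ n {P Q : Exponents → Bool} → (∀ e → P e ≡ Q e) → C n P ≡ C n Q
    pred-false : ∀ n → C n (λ _ → false) ≡ ℤ.+ 0

parityOK : Bool → ℕ → Bool
parityOK par n = if isEven n then par else not par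

-- series (catalanCount par (i , j , k)) is GF-sub par i j k, definitionally.
catalanCount : Bool → Exponents → Counting
catalanCount par σ n P =
  if parityOK par n then ℤ.+ count (λ w → P (weight σ w)) (catalanWords n) else ℤ.+ 0

oneCount : Counting
oneCount zero    P = ℤ.+ ind (P 0ₑ)
oneCount (suc n) P = ℤ.+ 0

catalanCount-isCounting : ∀ par σ → IsCounting (catalanCount par σ)
catalanCount-isCounting par σ = record
  { pred-cong  = λ n P≗Q → cong (guard n) (count-cong (λ w → P≗Q (weight σ w)) (catalanWords n))
  ; pred-false = λ n → trans (cong (guard n) (count-false (catalanWords n))) (if-eta (parityOK par n))
  }
  where
  guard : ℕ → ℕ → ℤ
  guard n k = if parityOK par n then ℤ.+ k else ℤ.+ 0

oneCount-isCounting : IsCounting oneCount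
oneCount-isCounting = record
  { pred-cong  = λ { zero P≗Q → cong (λ b → ℤ.+ ind b) (P≗Q 0ₑ) ; (suc n) _ → refl }
  ; pred-false = λ { zero → refl ; (suc n) → refl }
  }

one-series : one ≋ series oneCount
one-series zero    zero    zero    zero    = refl
one-series zero    zero    zero    (suc c) = refl
one-series zero    zero    (suc b) c       = refl
one-series zero    (suc a) b       c       = refl
one-series (suc n) a       b       c       = refl

matchesAt : Maybe ℕ → ℕ → Bool
matchesAt (just a) x = x ≡ᵇ a
matchesAt nothing  x = false

+-≡ᵇ : ∀ q x a → (q + x ≡ᵇ a) ≡ matchesAt (a -? q) x
+-≡ᵇ zero    x a       = refl
+-≡ᵇ (suc q) x zero    = refl
+-≡ᵇ (suc q) x (suc a) = +-≡ᵇ q x a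

module _ {C : Counting} (isC : IsCounting C) where
  open IsCounting isC

  coeffAt-series : ∀ n ma mb mc →
    coeffAt (series C) (just n) ma mb mc
      ≡ C n (λ (x , y , z) → matchesAt ma x ∧ matchesAt mb y ∧ matchesAt mc z)
  coeffAt-series n (just a) (just b) (just c) = refl
  coeffAt-series n nothing  mb       mc       = sym (pred-false n)
  coeffAt-series n (just a) nothing  mc       =
    sym (trans (pred-cong n (λ (x , _) → ∧-zeroʳ (x ≡ᵇ a))) (pred-false n))
  coeffAt-series n (just a) (just b) nothing  =
    sym (trans (pred-cong n (λ (x , y , _) →
                  trans (cong ((x ≡ᵇ a) ∧_) (∧-zeroʳ (y ≡ᵇ b))) (∧-zeroʳ (x ≡ᵇ a))))
               (pred-false n))

  monoMul-series : ∀ p q r s →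
    monoMul p q r s (series C) ≋ monoMul p 0 0 0 (series (shiftBy (q , r , s) C))
  monoMul-series p q r s n a b c = begin
    monoMul p q r s (series C) n a b c
      ≡⟨ monoMul-coeffAt p q r s _ n a b c ⟩
    coeffAt (series C) (n -? p) (a -? q) (b -? r) (c -? s)
      ≡⟨ shifted (n -? p) ⟩
    coeffAt (series (shiftBy (q , r , s) C)) (n -? p) (just a) (just b) (just c)
      ≡⟨ monoMul-coeffAt p 0 0 0 _ n a b c ⟨
    monoMul p 0 0 0 (series (shiftBy (q , r , s) C)) n a b c ∎
    where
    shifted : ∀ mn → coeffAt (series C) mn (a -? q) (b -? r) (c -? s)
                   ≡ coeffAt (series (shiftBy (q , r , s) C)) mn (just a) (just b) (just c)
    shifted nothing  = refl
    shifted (just n) = trans (coeffAt-series n (a -? q) (b -? r) (c -? s))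
      (pred-cong n (λ (x , y , z) →
         sym (cong₂ _∧_ (+-≡ᵇ q x a) (cong₂ _∧_ (+-≡ᵇ r y b) (+-≡ᵇ s z c)))))

monoMul-one : ∀ p q r s → monoMul p q r s one ≋ monoMul p 0 0 0 (series (shiftBy (q , r , s) oneCount))
monoMul-one p q r s n a b c =
  trans (monoMul-cong p q r s one-series n a b c) (monoMul-series oneCount-isCounting p q r s n a b c)

-- The functional equations

parityOK-not-suc : ∀ par m → parityOK (not par) (suc m) ≡ parityOK par m
parityOK-not-suc par zero          = not-involutive par
parityOK-not-suc par (suc zero)    = refl
parityOK-not-suc par (suc (suc m)) = parityOK-not-suc par m

parityOK⇒isEven : ∀ par n → parityOK par n ≡ true → isEven n ≡ par
parityOK⇒isEven par   zero          ok = sym ok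
parityOK⇒isEven false (suc zero)    _  = refl
parityOK⇒isEven true  (suc zero)    ()
parityOK⇒isEven par   (suc (suc n)) ok = parityOK⇒isEven par n ok

difference-cong : ∀ {m n p q} → m + q ≡ p + n → ℤ.+ m -ℤ ℤ.+ n ≡ ℤ.+ p -ℤ ℤ.+ q
difference-cong {m} {n} {p} {q} m+q≡p+n = begin
  ℤ.+ m -ℤ ℤ.+ n                              ≡⟨ pad (ℤ.+ m) (ℤ.+ n) (ℤ.+ q) ⟩
  ℤ.+ (m + q) -ℤ (ℤ.+ q +ℤ ℤ.+ n)             ≡⟨ cong (λ k → ℤ.+ k -ℤ (ℤ.+ q +ℤ ℤ.+ n)) m+q≡p+n ⟩
  ℤ.+ (p + n) -ℤ (ℤ.+ q +ℤ ℤ.+ n)             ≡⟨ unpad (ℤ.+ p) (ℤ.+ q) (ℤ.+ n) ⟩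
  ℤ.+ p -ℤ ℤ.+ q                              ∎
  where
  pad : ∀ x y z → x -ℤ y ≡ (x +ℤ z) -ℤ (z +ℤ y)
  pad = ℤ-Solver.solve-∀
  unpad : ∀ x y z → (x +ℤ z) -ℤ (y +ℤ z) ≡ x -ℤ y
  unpad = ℤ-Solver.solve-∀

guarded-difference : ∀ {b b'} {x y z w : ℕ} → b ≡ b' → (b ≡ true → x + w ≡ z + y) →
  (if b  then ℤ.+ x else ℤ.+ 0) -ℤ (if b  then ℤ.+ y else ℤ.+ 0)
    ≡ (if b' then ℤ.+ z else ℤ.+ 0) -ℤ (if b' then ℤ.+ w else ℤ.+ 0)
guarded-difference {true}  {x = x} {y} {z} {w} refl balanced = difference-cong {x} {y} {z} {w} (balanced refl)
guarded-difference {false}                     refl _        = refl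

GF-telescope : ∀ par σ m a b c → let μ = ratio par σ in
  series (shiftBy μ (catalanCount par σ)) (2 + m) a b c -ℤ series (catalanCount par σ) (2 + m) a b c
    ≡ series (shiftBy (μ ⊞ μ) (catalanCount (not par) μ)) (suc m) a b c
      -ℤ series (shiftBy μ (catalanCount (not par) 0ₑ)) (suc m) a b c
GF-telescope par σ m a b c =
  guarded-difference (sym (parityOK-not-suc par m))
                     (λ ok → count-telescope par σ m (a , b , c) (parityOK⇒isEven par m ok))

EV-coefficients : ∀ σ n a b c → let μ = ratio true σ in
  series (shiftBy μ (catalanCount true σ)) n a b c -ℤ series (catalanCount true σ) n a b c
    ≡ monoMul 1 0 0 0 (series (shiftBy (μ ⊞ μ) (catalanCount false μ))) n a b c
      -ℤ monoMul 1 0 0 0 (series (shiftBy μ (catalanCount false 0ₑ))) n a b c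
EV-coefficients σ zero          a b c = refl
EV-coefficients σ (suc zero)    a b c = refl
EV-coefficients σ (suc (suc m)) a b c = GF-telescope true σ m a b c

-- The one-column polyomino extends no shorter one: it enters as if EV also counted the empty polyomino,
-- whose series is one.
single-column : ∀ σ abc → let μ = ratio false σ; hits = λ e → ind (e ≡³ᵇ abc) in
  ℤ.+ (hits (μ ⊞ weight σ (0 ∷ [])) + 0) -ℤ ℤ.+ (hits (weight σ (0 ∷ [])) + 0)
    ≡ (ℤ.+ hits (μ ⊞ μ ⊞ 0ₑ) -ℤ ℤ.+ hits (μ ⊞ 0ₑ)) +ℤ ℤ.+ 0
single-column σ abc = begin
  ℤ.+ (hits (μ ⊞ weight σ (0 ∷ [])) + 0) -ℤ ℤ.+ (hits (weight σ (0 ∷ [])) + 0)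
    ≡⟨ cong₂ (λ x y → ℤ.+ (hits x + 0) -ℤ ℤ.+ (hits y + 0)) two-cells one-cell ⟩
  ℤ.+ (hits (μ ⊞ μ ⊞ 0ₑ) + 0) -ℤ ℤ.+ (hits (μ ⊞ 0ₑ) + 0)
    ≡⟨ cong₂ (λ x y → ℤ.+ x -ℤ ℤ.+ y) (+-identityʳ _) (+-identityʳ (hits (μ ⊞ 0ₑ))) ⟩
  ℤ.+ hits (μ ⊞ μ ⊞ 0ₑ) -ℤ ℤ.+ hits (μ ⊞ 0ₑ)
    ≡⟨ ℤP.+-identityʳ _ ⟨
  (ℤ.+ hits (μ ⊞ μ ⊞ 0ₑ) -ℤ ℤ.+ hits (μ ⊞ 0ₑ)) +ℤ ℤ.+ 0 ∎
  where
  μ = ratio false σ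
  hits : Exponents → ℕ
  hits e = ind (e ≡³ᵇ abc)
  one-cell : weight σ (0 ∷ []) ≡ μ ⊞ 0ₑ
  one-cell = trans (weight-snoc σ [] 0) (trans (sym (⊞-⊠-suc μ 0ₑ 0)) (cong (μ ⊞_) (⊠-zeroʳ μ)))
  two-cells : μ ⊞ weight σ (0 ∷ []) ≡ μ ⊞ μ ⊞ 0ₑ
  two-cells = trans (cong (μ ⊞_) one-cell) (sym (⊞-assoc μ μ 0ₑ))

OD-coefficients : ∀ σ n a b c → let μ = ratio false σ in
  series (shiftBy μ (catalanCount false σ)) n a b c -ℤ series (catalanCount false σ) n a b c
    ≡ (monoMul 1 0 0 0 (series (shiftBy (μ ⊞ μ) oneCount)) n a b c
       -ℤ monoMul 1 0 0 0 (series (shiftBy μ oneCount)) n a b c)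
      +ℤ (monoMul 1 0 0 0 (series (shiftBy (μ ⊞ μ) (catalanCount true μ))) n a b c
          -ℤ monoMul 1 0 0 0 (series (shiftBy μ (catalanCount true 0ₑ))) n a b c)
OD-coefficients σ zero          a b c = refl
OD-coefficients σ (suc zero)    a b c = single-column σ (a , b , c)
OD-coefficients σ (suc (suc m)) a b c = trans (GF-telescope false σ m a b c) (sym (ℤP.+-identityˡ _))

EV-equation : ∀ i j k →
  (mono 0 i (suc j) k -ₚ 1ₚ) · EV-sub i j k
    ≋ mono 1 (i + i) (suc j + suc j) (k + k) · OD-sub i (suc j) k ⊖ mono 1 i (suc j) k · OD-sub 0 0 0
EV-equation i j k n a b c = begin
  at ((mono 0 i (suc j) k -ₚ 1ₚ) · EV-sub i j k)
    ≡⟨ binomial-· 0 i (suc j) k 0 0 0 0 (EV-sub i j k) n a b c ⟩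
  at (monoMul 0 i (suc j) k (EV-sub i j k)) -ℤ at (EV-sub i j k)
    ≡⟨ cong (_-ℤ at (EV-sub i j k)) (monoMul-series (isCounting true σ) 0 i (suc j) k n a b c) ⟩
  at (series (shiftBy μ (catalanCount true σ))) -ℤ at (series (catalanCount true σ))
    ≡⟨ EV-coefficients σ n a b c ⟩
  at (monoMul 1 0 0 0 (series (shiftBy (μ ⊞ μ) (catalanCount false μ))))
    -ℤ at (monoMul 1 0 0 0 (series (shiftBy μ (catalanCount false 0ₑ))))
    ≡⟨ cong₂ _-ℤ_ (monoMul-series (isCounting false μ) 1 (i + i) (suc j + suc j) (k + k) n a b c)
                  (monoMul-series (isCounting false 0ₑ) 1 i (suc j) k n a b c) ⟨
  at (monoMul 1 (i + i) (suc j + suc j) (k + k) (OD-sub i (suc j) k)) -ℤ at (monoMul 1 i (suc j) k (OD-sub 0 0 0))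
    ≡⟨ cong₂ _-ℤ_ (mono-· 1 (i + i) (suc j + suc j) (k + k) (OD-sub i (suc j) k) n a b c)
                  (mono-· 1 i (suc j) k (OD-sub 0 0 0) n a b c) ⟨
  at (mono 1 (i + i) (suc j + suc j) (k + k) · OD-sub i (suc j) k ⊖ mono 1 i (suc j) k · OD-sub 0 0 0) ∎
  where
  σ = i , j , k
  μ = ratio true σ
  isCounting = catalanCount-isCounting
  at : Series → ℤ
  at F = F n a b c

OD-equation : ∀ i j k →
  (mono 0 (suc i) j k -ₚ 1ₚ) · OD-sub i j k
    ≋ ((mono 0 (suc i) j k -ₚ 1ₚ) *ₚ mono 1 (suc i) j k) · one
      ⊕ mono 1 (suc i + suc i) (j + j) (k + k) · EV-sub (suc i) j k ⊖ mono 1 (suc i) j k · EV-sub 0 0 0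
OD-equation i j k n a b c = begin
  at ((mono 0 (suc i) j k -ₚ 1ₚ) · OD-sub i j k)
    ≡⟨ binomial-· 0 (suc i) j k 0 0 0 0 (OD-sub i j k) n a b c ⟩
  at (monoMul 0 (suc i) j k (OD-sub i j k)) -ℤ at (OD-sub i j k)
    ≡⟨ cong (_-ℤ at (OD-sub i j k)) (monoMul-series (isCounting false σ) 0 (suc i) j k n a b c) ⟩
  at (series (shiftBy μ (catalanCount false σ))) -ℤ at (series (catalanCount false σ))
    ≡⟨ OD-coefficients σ n a b c ⟩
  (at (monoMul 1 0 0 0 (series (shiftBy (μ ⊞ μ) oneCount)))
     -ℤ at (monoMul 1 0 0 0 (series (shiftBy μ oneCount))))
    +ℤ (at (monoMul 1 0 0 0 (series (shiftBy (μ ⊞ μ) (catalanCount true μ))))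
        -ℤ at (monoMul 1 0 0 0 (series (shiftBy μ (catalanCount true 0ₑ)))))
    ≡⟨ cong₂ _+ℤ_ (cong₂ _-ℤ_ (monoMul-one 1 (suc i + suc i) (j + j) (k + k) n a b c)
                              (monoMul-one 1 (suc i) j k n a b c))
                  (cong₂ _-ℤ_ (monoMul-series (isCounting true μ) 1 (suc i + suc i) (j + j) (k + k) n a b c)
                              (monoMul-series (isCounting true 0ₑ) 1 (suc i) j k n a b c)) ⟨
  (at (monoMul 1 (suc i + suc i) (j + j) (k + k) one) -ℤ at (monoMul 1 (suc i) j k one))
    +ℤ (at (monoMul 1 (suc i + suc i) (j + j) (k + k) (EV-sub (suc i) j k))
        -ℤ at (monoMul 1 (suc i) j k (EV-sub 0 0 0)))
    ≡⟨ cong₂ _+ℤ_ (binomial-· 1 (suc i + suc i) (j + j) (k + k) 1 (suc i) j k one n a b c)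
                  (cong₂ _-ℤ_ (mono-· 1 (suc i + suc i) (j + j) (k + k) (EV-sub (suc i) j k) n a b c)
                              (mono-· 1 (suc i) j k (EV-sub 0 0 0) n a b c)) ⟨
  at (((mono 0 (suc i) j k -ₚ 1ₚ) *ₚ mono 1 (suc i) j k) · one)
    +ℤ (at (mono 1 (suc i + suc i) (j + j) (k + k) · EV-sub (suc i) j k)
        -ℤ at (mono 1 (suc i) j k · EV-sub 0 0 0))
    ≡⟨ ℤP.+-assoc (at (((mono 0 (suc i) j k -ₚ 1ₚ) *ₚ mono 1 (suc i) j k) · one))
                  (at (mono 1 (suc i + suc i) (j + j) (k + k) · EV-sub (suc i) j k))
                  (-ℤ at (mono 1 (suc i) j k · EV-sub 0 0 0)) ⟨
  at (((mono 0 (suc i) j k -ₚ 1ₚ) *ₚ mono 1 (suc i) j k) · one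
      ⊕ mono 1 (suc i + suc i) (j + j) (k + k) · EV-sub (suc i) j k ⊖ mono 1 (suc i) j k · EV-sub 0 0 0) ∎
  where
  σ = i , j , k
  μ = ratio false σ
  isCounting = catalanCount-isCounting
  at : Series → ℤ
  at F = F n a b c

-- The matrix equation

matrix-row-EV : ((mono 0 0 1 1 -ₚ 1ₚ) *ₚ (mono 0 1 1 1 -ₚ 1ₚ)) · EV
                ≋ mono 2 2 4 4 · EV-sub 1 1 1
                  ⊖ mono 2 1 3 3 · EV-sub 0 0 0
                  ⊖ (mono 1 0 1 1 *ₚ (mono 0 1 1 1 -ₚ 1ₚ)) · OD-sub 0 0 0
                  ⊕ (mono 2 1 3 3 *ₚ (mono 0 1 1 1 -ₚ 1ₚ)) · one
matrix-row-EV n a b c = begin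
  at ((zu-1 *ₚ yzu-1) · EV)
    ≡⟨ eliminate zu-1 yzu-1 xz²u² (EV-equation 0 0 1) (OD-equation 0 1 1) n a b c ⟩
  at (xz²u² · (κ · one ⊕ xy²z²u² · E₁ ⊖ xyzu · E₀)) +ℤ at (yzu-1 · (⊖ (xzu · O₀)))
    ≡⟨ cong₂ _+ℤ_ (·-⊕ xz²u² (κ · one ⊕ xy²z²u² · E₁) (⊖ (xyzu · E₀)) n a b c)
                  (·-⊖ yzu-1 (xzu · O₀) n a b c) ⟩
  (at (xz²u² · (κ · one ⊕ xy²z²u² · E₁)) +ℤ at (xz²u² · (⊖ (xyzu · E₀)))) +ℤ -ℤ at (yzu-1 · (xzu · O₀))
    ≡⟨ cong₂ (λ x y → (x +ℤ y) +ℤ -ℤ at (yzu-1 · (xzu · O₀)))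
             (·-⊕ xz²u² (κ · one) (xy²z²u² · E₁) n a b c) (·-⊖ xz²u² (xyzu · E₀) n a b c) ⟩
  ((at (xz²u² · (κ · one)) +ℤ at (xz²u² · (xy²z²u² · E₁))) +ℤ -ℤ at (xz²u² · (xyzu · E₀)))
    +ℤ -ℤ at (yzu-1 · (xzu · O₀))
    ≡⟨ cong₂ (λ x y → x +ℤ -ℤ y)
             (cong₂ (λ x y → x +ℤ -ℤ y)
                    (cong₂ _+ℤ_ (·-·-swap xz²u² κ one n a b c) (·-·-swap xz²u² xy²z²u² E₁ n a b c))
                    (·-·-swap xz²u² xyzu E₀ n a b c))
             (·-·-swap yzu-1 xzu O₀ n a b c) ⟩
  ((at ((mono 2 1 3 3 *ₚ yzu-1) · one) +ℤ at (mono 2 2 4 4 · E₁)) +ℤ -ℤ at (mono 2 1 3 3 · E₀))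
    +ℤ -ℤ at ((xzu *ₚ yzu-1) · O₀)
    ≡⟨ rearrange (at ((mono 2 1 3 3 *ₚ yzu-1) · one)) (at (mono 2 2 4 4 · E₁))
                 (at (mono 2 1 3 3 · E₀)) (at ((xzu *ₚ yzu-1) · O₀)) ⟩
  at (mono 2 2 4 4 · E₁ ⊖ mono 2 1 3 3 · E₀ ⊖ (xzu *ₚ yzu-1) · O₀ ⊕ (mono 2 1 3 3 *ₚ yzu-1) · one) ∎
  where
  zu-1 yzu-1 xz²u² xy²z²u² xyzu xzu κ : Poly
  zu-1    = mono 0 0 1 1 -ₚ 1ₚ
  yzu-1   = mono 0 1 1 1 -ₚ 1ₚ
  xz²u²   = mono 1 0 2 2
  xy²z²u² = mono 1 2 2 2
  xyzu    = mono 1 1 1 1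
  xzu     = mono 1 0 1 1
  κ       = yzu-1 *ₚ xyzu

  E₁ E₀ O₀ : Series
  E₁ = EV-sub 1 1 1
  E₀ = EV-sub 0 0 0
  O₀ = OD-sub 0 0 0

  at : Series → ℤ
  at F = F n a b c

  rearrange : ∀ x y z w → ((x +ℤ y) +ℤ -ℤ z) +ℤ -ℤ w ≡ ((y +ℤ -ℤ z) +ℤ -ℤ w) +ℤ x
  rearrange = ℤ-Solver.solve-∀

matrix-row-OD : ((mono 0 1 0 1 -ₚ 1ₚ) *ₚ (mono 0 1 1 1 -ₚ 1ₚ)) · OD
                ≋ mono 2 4 2 4 · OD-sub 1 1 1
                  ⊖ (mono 1 1 0 1 *ₚ (mono 0 1 1 1 -ₚ 1ₚ)) · EV-sub 0 0 0
                  ⊖ mono 2 3 1 3 · OD-sub 0 0 0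
                  ⊕ (mono 1 1 0 1 *ₚ (mono 0 1 0 1 -ₚ 1ₚ) *ₚ (mono 0 1 1 1 -ₚ 1ₚ)) · one
matrix-row-OD n a b c = begin
  at ((yu-1 *ₚ yzu-1) · OD)
    ≡⟨ eliminate yu-1 yzu-1 xy²u² OD-equation′ (EV-equation 1 0 1) n a b c ⟩
  at (xy²u² · (xy²z²u² · O₁ ⊖ xyzu · O₀)) +ℤ at (yzu-1 · (κ · one ⊖ xyu · E₀))
    ≡⟨ cong₂ _+ℤ_ (·-⊕ xy²u² (xy²z²u² · O₁) (⊖ (xyzu · O₀)) n a b c)
                  (·-⊕ yzu-1 (κ · one) (⊖ (xyu · E₀)) n a b c) ⟩
  (at (xy²u² · (xy²z²u² · O₁)) +ℤ at (xy²u² · (⊖ (xyzu · O₀))))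
    +ℤ (at (yzu-1 · (κ · one)) +ℤ at (yzu-1 · (⊖ (xyu · E₀))))
    ≡⟨ cong₂ _+ℤ_
         (cong₂ _+ℤ_ (·-·-swap xy²u² xy²z²u² O₁ n a b c)
                     (trans (·-⊖ xy²u² (xyzu · O₀) n a b c) (cong -ℤ_ (·-·-swap xy²u² xyzu O₀ n a b c))))
         (cong₂ _+ℤ_ (·-·-swap yzu-1 κ one n a b c)
                     (trans (·-⊖ yzu-1 (xyu · E₀) n a b c) (cong -ℤ_ (·-·-swap yzu-1 xyu E₀ n a b c)))) ⟩
  (at (mono 2 4 2 4 · O₁) +ℤ -ℤ at (mono 2 3 1 3 · O₀))
    +ℤ (at ((xyu *ₚ yu-1 *ₚ yzu-1) · one) +ℤ -ℤ at ((xyu *ₚ yzu-1) · E₀))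
    ≡⟨ reorder (at (mono 2 4 2 4 · O₁)) (at (mono 2 3 1 3 · O₀))
               (at ((xyu *ₚ yu-1 *ₚ yzu-1) · one)) (at ((xyu *ₚ yzu-1) · E₀)) ⟩
  at (mono 2 4 2 4 · O₁ ⊖ (xyu *ₚ yzu-1) · E₀ ⊖ mono 2 3 1 3 · O₀ ⊕ (xyu *ₚ yu-1 *ₚ yzu-1) · one) ∎
  where
  yu-1 yzu-1 xyu xy²u² xyzu xy²z²u² κ : Poly
  yu-1    = mono 0 1 0 1 -ₚ 1ₚ
  yzu-1   = mono 0 1 1 1 -ₚ 1ₚ
  xyu     = mono 1 1 0 1
  xy²u²   = mono 1 2 0 2
  xyzu    = mono 1 1 1 1
  xy²z²u² = mono 1 2 2 2
  κ       = yu-1 *ₚ xyu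

  O₁ O₀ E₀ : Series
  O₁ = OD-sub 1 1 1
  O₀ = OD-sub 0 0 0
  E₀ = EV-sub 0 0 0

  at : Series → ℤ
  at F = F n a b c

  OD-equation′ : yu-1 · OD ≋ xy²u² · EV-sub 1 0 1 ⊕ (κ · one ⊖ xyu · E₀)
  OD-equation′ n a b c = trans (OD-equation 0 0 1 n a b c)
    (shuffle ((κ · one) n a b c) ((xy²u² · EV-sub 1 0 1) n a b c) ((xyu · E₀) n a b c))
    where
    shuffle : ∀ x y z → (x +ℤ y) +ℤ -ℤ z ≡ y +ℤ (x +ℤ -ℤ z)
    shuffle = ℤ-Solver.solve-∀

  reorder : ∀ p q r s → (p +ℤ -ℤ q) +ℤ (r +ℤ -ℤ s) ≡ ((p +ℤ -ℤ s) +ℤ -ℤ q) +ℤ r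
  reorder = ℤ-Solver.solve-∀

theorem4p1 :
  -- EV(u) = xzu/(zu-1) (uz OD(zu) - OD(1)), denominators cleared
  ( (mono 0 0 1 1 -ₚ 1ₚ) · EV
      ≋ mono 1 0 2 2 · OD-sub 0 1 1 ⊖ mono 1 0 1 1 · OD-sub 0 0 0 )
  -- OD(u) = xyu + xyu/(yu-1) (uy EV(yu) - EV(1)), denominators cleared
  × ( (mono 0 1 0 1 -ₚ 1ₚ) · OD
      ≋ ((mono 0 1 0 1 -ₚ 1ₚ) *ₚ mono 1 1 0 1) · one
        ⊕ mono 1 2 0 2 · EV-sub 1 0 1 ⊖ mono 1 1 0 1 · EV-sub 0 0 0 )
  -- matrix equation V(u) = M(u) V(yzu) - N(u) V(1) + B(u), first row,
  -- multiplied by (uz-1)(uyz-1)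
  × ( ((mono 0 0 1 1 -ₚ 1ₚ) *ₚ (mono 0 1 1 1 -ₚ 1ₚ)) · EV
      ≋ mono 2 2 4 4 · EV-sub 1 1 1
        ⊖ mono 2 1 3 3 · EV-sub 0 0 0
        ⊖ (mono 1 0 1 1 *ₚ (mono 0 1 1 1 -ₚ 1ₚ)) · OD-sub 0 0 0
        ⊕ (mono 2 1 3 3 *ₚ (mono 0 1 1 1 -ₚ 1ₚ)) · one )
  -- second row, multiplied by (uy-1)(uyz-1)
  × ( ((mono 0 1 0 1 -ₚ 1ₚ) *ₚ (mono 0 1 1 1 -ₚ 1ₚ)) · OD
      ≋ mono 2 4 2 4 · OD-sub 1 1 1
        ⊖ (mono 1 1 0 1 *ₚ (mono 0 1 1 1 -ₚ 1ₚ)) · EV-sub 0 0 0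
        ⊖ mono 2 3 1 3 · OD-sub 0 0 0
        ⊕ (mono 1 1 0 1 *ₚ (mono 0 1 0 1 -ₚ 1ₚ) *ₚ (mono 0 1 1 1 -ₚ 1ₚ)) · one )
theorem4p1 = EV-equation 0 0 1 , OD-equation 0 0 1 , matrix-row-EV , matrix-row-OD
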